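{- For every integer $n\ge 1$ and each $m\in\{1,2,3\}$, $\chi_{la}(H_m(n))=3$.
   Context: For a graph $G=(V,E)$ with $|E|=m$ and no isolated vertices, a local antimagic labeling is a bijection $f:E\to\{1,\dots,m\}$ such that $f^+(u)\ne f^+(v)$ for every edge $uv$, where $f^+(x)=\sum f(e)$ over all edges $e$ incident to $x$. The local antimagic chromatic number $\chi_{la}(G)$ is the minimum, over all local antimagic labelings $f$ of $G$, of the number of distinct values taken by $f^+$ (also for disconnected graphs). Merging a set of vertices means identifying them into one vertex incident to all edges previously incident to any of them. Take $n$ disjoint copies of $C_4(8,2)$ indexed $i=1,\dots,n$, the $i$-th copy having vertices $\{u_{i,t},v_{i,t}:1\le t\le 8\}$ and edges $u_{i,t}u_{i,t+1}$, $v_{i,t}v_{i,t+1}$ ($1\le t\le 8$, second index mod 8) and $u_{i,2j}v_{i,2j}$ ($1\le j\le 4$). For each $i\in[1,n]$: $H_1(n)$ is obtained by merging $\{u_{i,1},u_{i,5}\}$, $\{u_{i,3},u_{i,7}\}$, $\{v_{i,1},v_{i,5}\}$, $\{v_{i,3},v_{i,7}\}$ (each pair into one degree-4 vertex); $H_2(n)$ is obtained by merging $\{u_{i,1},v_{i,7}\}$, $\{u_{i,5},v_{i,3}\}$, $\{u_{i,3},v_{i,5}\}$, $\{u_{i,7},v_{i,1}\}$; $H_3(n)$ is obtained by merging $\{u_{i,1},v_{i,1}\}$, $\{u_{i,5},v_{i,5}\}$, $\{u_{i,3},v_{i,3}\}$, $\{u_{i,7},v_{i,7}\}$. -}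

module Defs where

open import Data.Nat using (ℕ; zero; suc; _+_; _*_; _≤_)
open import Data.Nat.Properties using (_≟_)
open import Data.Fin using (Fin; #_; toℕ; combine; remQuot)

open import Data.Fin.Properties using () renaming (_≟_ to _≟ᶠ_)
open import Data.Nat.ListAction using (sum)
open import Data.Vec using (Vec; []; _∷_; lookup)
open import Data.List using (List; map; length; deduplicate; allFin)
open import Data.Product using (_×_; _,_; proj₁; proj₂; ∃-syntax)
open import Data.Bool using (if_then_else_; _∨_)
open import Relation.Nullary.Decidable using (⌊_⌋)
open import Relation.Binary.PropositionalEquality using (_≡_)
open import Function.Definitions using (Bijective)

record Graph : Set where
  field
    nV   : ℕ
    nE   : ℕ
    ends : Fin nE → Fin nV × Fin nV
open Graph public

-- An edge labeling: a bijection f : E → {1,…,m}.  We represent the label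
-- set {1,…,m} by Fin m, label of e being  suc (toℕ (f e)).
Labeling : Graph → Set
Labeling G = Fin (nE G) → Fin (nE G)

label : (G : Graph) → Labeling G → Fin (nE G) → ℕ
label G f e = suc (toℕ (f e))

incident : (G : Graph) → Fin (nV G) → Fin (nE G) → Data.Bool.Bool
incident G x e = ⌊ proj₁ (ends G e) ≟ᶠ x ⌋ ∨ ⌊ proj₂ (ends G e) ≟ᶠ x ⌋

vsum : (G : Graph) → Labeling G → Fin (nV G) → ℕ
vsum G f x = sum (map (λ e → if incident G x e then label G f e else 0) (allFin (nE G)))

IsLocalAntimagic : (G : Graph) → Labeling G → Set
IsLocalAntimagic G f =
  Bijective _≡_ _≡_ f ×
  (∀ e → vsum G f (proj₁ (ends G e)) ≡ vsum G f (proj₂ (ends G e)) → Data.Empty.⊥)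
  where import Data.Empty

numColors : (G : Graph) → Labeling G → ℕ
numColors G f = length (deduplicate _≟_ (map (vsum G f) (allFin (nV G))))

χla≡ : Graph → ℕ → Set
χla≡ G k =
  (∃[ f ] (IsLocalAntimagic G f × numColors G f ≡ k)) ×
  (∀ f → IsLocalAntimagic G f → k ≤ numColors G f)

-- The base graph C4(8,2): vertices u_t ↦ t-1 (0..7), v_t ↦ 8+t-1 (8..15).
-- Edges (20, in this order): u_t u_{t+1} (t=1..8), v_t v_{t+1} (t=1..8),
-- u_{2j} v_{2j} (j=1..4).

baseEnds : Vec (Fin 16 × Fin 16) 20
baseEnds =
  ((# 0) , (# 1)) ∷ ((# 1) , (# 2)) ∷ ((# 2) , (# 3)) ∷ ((# 3) , (# 4)) ∷
  ((# 4) , (# 5)) ∷ ((# 5) , (# 6)) ∷ ((# 6) , (# 7)) ∷ ((# 7) , (# 0)) ∷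
  ((# 8) , (# 9)) ∷ ((# 9) , (# 10)) ∷ ((# 10) , (# 11)) ∷ ((# 11) , (# 12)) ∷
  ((# 12) , (# 13)) ∷ ((# 13) , (# 14)) ∷ ((# 14) , (# 15)) ∷ ((# 15) , (# 8)) ∷
  ((# 1) , (# 9)) ∷ ((# 3) , (# 11)) ∷ ((# 5) , (# 13)) ∷ ((# 7) , (# 15)) ∷ []

-- Merging maps Fin 16 → Fin 12 (vertex of C4(8,2) ↦ vertex of the merged copy).
-- Each identifies exactly four disjoint pairs and is otherwise injective.

-- H₁: {u1,u5} {u3,u7} {v1,v5} {v3,v7}
merge₁ : Vec (Fin 12) 16
merge₁ =
     (# 0) ∷ (# 1) ∷ (# 2) ∷ (# 3) ∷ (# 0) ∷ (# 4) ∷ (# 2) ∷ (# 5) ∷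
     (# 6) ∷ (# 7) ∷ (# 8) ∷ (# 9) ∷ (# 6) ∷ (# 10) ∷ (# 8) ∷ (# 11) ∷ []

-- H₂: {u1,v7} {u5,v3} {u3,v5} {u7,v1}
merge₂ : Vec (Fin 12) 16
merge₂ =
     (# 0) ∷ (# 1) ∷ (# 2) ∷ (# 3) ∷ (# 4) ∷ (# 5) ∷ (# 6) ∷ (# 7) ∷
     (# 6) ∷ (# 8) ∷ (# 4) ∷ (# 9) ∷ (# 2) ∷ (# 10) ∷ (# 0) ∷ (# 11) ∷ []

-- H₃: {u1,v1} {u5,v5} {u3,v3} {u7,v7}
merge₃ : Vec (Fin 12) 16
merge₃ =
     (# 0) ∷ (# 1) ∷ (# 2) ∷ (# 3) ∷ (# 4) ∷ (# 5) ∷ (# 6) ∷ (# 7) ∷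
     (# 0) ∷ (# 8) ∷ (# 2) ∷ (# 9) ∷ (# 4) ∷ (# 10) ∷ (# 6) ∷ (# 11) ∷ []

mergedCopies : Vec (Fin 12) 16 → ℕ → Graph
mergedCopies φ n = record
  { nV   = n * 12
  ; nE   = n * 20
  ; ends = λ e → let (i , b) = remQuot {n} 20 e
                     (x , y) = lookup baseEnds b
                 in combine i (lookup φ x) , combine i (lookup φ y)
  }

H₁ H₂ H₃ : ℕ → Graph
H₁ = mergedCopies merge₁
H₂ = mergedCopies merge₂
H₃ = mergedCopies merge₃

-- For the lower bound: in H₂ and H₃ the vertices u₁ and v₇, resp. u₁ and v₁, are merged,
-- which closes a triangle, and the three vertices of a triangle carry three different sums.
-- A copy of H₁ is bipartite with classes of size six.  If only two sums A ≠ B occurred,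
-- then along paths of length two the sums on each class of a copy would be constant, A on
-- one class and B on the other, and adding up the labels of the copy once from each class
-- gives 6A = 6B.
--
-- For the upper bound, cut the labels 1, …, 20n into ten blocks of 2n consecutive labels,
-- and let each block serve two of the twenty edges of the base graph, either as lower and
-- upper half or alternately.  Within its half, copy i gets position i or n - 1 - i.  Every
-- label is then an affine function of k = i and r = n - 1 - i.  For suitable choices of
-- slots and directions every vertex sum comes out as C + A(k + r) = C + A(n - 1), with
-- (C, A) one of three pairs, so the sum does not depend on the copy, and the two ends of
-- every edge get different pairs.

module Submission where

open import Defs
open import Data.Bool using (Bool; true; false; if_then_else_; _∧_; _∨_; not)
open import Data.Empty using (⊥)
open import Data.Fin using (Fin; zero; suc; #_; toℕ; combine; remQuot; _↑ˡ_; _↑ʳ_; cast; opposite; punchIn; punchOut)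
open import Data.Fin.Patterns using (0F; 1F; 2F; 3F; 4F; 5F; 6F; 7F; 8F; 9F)
open import Data.Fin.Properties
  using ( all?; any?; toℕ-injective; toℕ-cast; toℕ-combine; toℕ≤pred[n]; combine-injective; combine-injectiveˡ
        ; combine-injectiveʳ; combine-remQuot; remQuot-combine; opposite-prop; opposite-involutive
        ; punchInᵢ≢i; punchOut-injective; injective⇒≤)
  renaming (_≟_ to _≟ᶠ_)
open import Data.List using (List; []; _∷_; length; deduplicate; filter; map; allFin; tabulate)
open import Data.List.Membership.Propositional using (_∈_)
open import Data.List.Membership.Propositional.Properties
  using (∈-filter⁺; ∈-deduplicate⁺; ∈-deduplicate⁻; ∈-map⁺; ∈-map⁻; ∈-allFin; ∈-tabulate⁺)
open import Data.List.Properties using (filter-notAll; length-tabulate; map-tabulate)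
open import Data.List.Relation.Binary.Subset.Propositional using (_⊆_)
open import Data.List.Relation.Unary.All as All using ()
open import Data.List.Relation.Unary.Any as Any using (here; there)
open import Data.List.Relation.Unary.AllPairs using ([]; _∷_)
open import Data.List.Relation.Unary.Unique.Propositional using (Unique)
open import Data.List.Relation.Unary.Unique.DecPropositional.Properties using (deduplicate-!)
open import Data.Nat using (ℕ; zero; suc; _+_; _*_; _≤_; _<_; z≤n; s≤s; NonZero)
import Data.Nat.ListAction as List
open import Data.Nat.Properties
  using ( +-*-semiring; _≟_; _<?_; _≤?_; +-assoc; +-identityʳ; *-identityˡ; *-comm; *-assoc; *-cancelˡ-≡; suc-injective
        ; m+[n∸m]≡n; +-mono-<-≤; *-monoˡ-≤; ≤-trans; ≤-reflexive; ≤-antisym; <⇒≢; <⇒≱; ≮⇒≥; 1+n≰n)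
open import Algebra.Properties.Semiring.Sum +-*-semiring
  using (sum; sum-syntax; sum-cong-≗; ∑-comm; *-distribʳ-sum; sum-remove; sum-replicate-zero)
open import Data.Nat.Tactic.RingSolver using (solve-∀)
open import Data.Product using (_×_; _,_; proj₁; proj₂; ∃-syntax; swap; uncurry)
open import Data.Product.Properties using (≡-dec)
open import Data.Sum using (_⊎_; inj₁; inj₂)
open import Data.Vec using (Vec; []; _∷_; lookup)
import Data.Vec.Functional as Vector
open import Function using (_∘_; id)
open import Function.Definitions using (Injective; Surjective; Bijective)
open import Relation.Binary using (Decidable)
open import Relation.Binary.PropositionalEquality
open import Relation.Nullary using (Dec; yes; no; ¬?; contradiction)
open import Relation.Nullary.Decidable using (⌊_⌋; True; toWitness; map′; _×-dec_; _⊎-dec_; _→-dec_)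

-- Finite sums

sum-tabulate : ∀ {n} (h : Fin n → ℕ) → List.sum (tabulate h) ≡ ∑[ i < n ] h i
sum-tabulate {zero}  h = refl
sum-tabulate {suc n} h = cong (h zero +_) (sum-tabulate (h ∘ suc))

∑-split : ∀ m {n} (h : Fin (m + n) → ℕ) →
          ∑[ e < m + n ] h e ≡ ∑[ i < m ] h (i ↑ˡ n) + ∑[ j < n ] h (m ↑ʳ j)
∑-split zero    h = refl
∑-split (suc m) {n} h =
  trans (cong (h zero +_) (∑-split m (h ∘ suc)))
        (sym (+-assoc (h zero) (∑[ i < m ] h (suc (i ↑ˡ n))) (∑[ j < n ] h (suc m ↑ʳ j))))

∑-combine : ∀ m {n} (h : Fin (m * n) → ℕ) →
            ∑[ e < m * n ] h e ≡ ∑[ i < m ] ∑[ j < n ] h (combine i j)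
∑-combine zero        h = refl
∑-combine (suc m) {n} h =
  trans (∑-split n h) (cong (∑[ j < n ] h (j ↑ˡ m * n) +_) (∑-combine m (λ e → h (n ↑ʳ e))))

∑-concentrated : ∀ {n} (h : Fin n → ℕ) i → (∀ j → j ≢ i → h j ≡ 0) → ∑[ j < n ] h j ≡ h i
∑-concentrated {suc n} h i h≡0 = begin
  sum h                             ≡⟨ sum-remove h ⟩
  h i + ∑[ j < n ] h (punchIn i j)  ≡⟨ cong (h i +_) (sum-cong-≗ (λ j → h≡0 _ (punchInᵢ≢i i j))) ⟩
  h i + ∑[ j < n ] 0                ≡⟨ cong (h i +_) (sum-replicate-zero n) ⟩
  h i + 0                           ≡⟨ +-identityʳ (h i) ⟩
  h i                               ∎
  where open ≡-Reasoning

if-then-0≡* : ∀ c w → (if c then w else 0) ≡ (if c then 1 else 0) * w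
if-then-0≡* true  w = sym (*-identityˡ w)
if-then-0≡* false w = refl

count : ∀ {V} → (Fin V → Bool) → ℕ
count {V} side = ∑[ x < V ] (if side x then 1 else 0)

∑-sideConstant : ∀ {V} (side : Fin V → Bool) A B →
  ∑[ x < V ] (if side x then (if side x then A else B) else 0) ≡ count side * A
∑-sideConstant side A B = trans (sum-cong-≗ pointwise) (sym (*-distribʳ-sum A (λ x → if side x then 1 else 0)))
  where
  pointwise : ∀ x → (if side x then (if side x then A else B) else 0) ≡ (if side x then 1 else 0) * A
  pointwise x with side x
  ... | true  = sym (*-identityˡ A)
  ... | false = refl

∑-otherSideConstant : ∀ {V} (side : Fin V → Bool) A B →
  ∑[ x < V ] (if not (side x) then (if side x then A else B) else 0) ≡ count (not ∘ side) * B
∑-otherSideConstant side A B = trans (sum-cong-≗ pointwise) (sym (*-distribʳ-sum B (λ x → if not (side x) then 1 else 0)))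
  where
  pointwise : ∀ x → (if not (side x) then (if side x then A else B) else 0) ≡ (if not (side x) then 1 else 0) * B
  pointwise x with side x
  ... | true  = refl
  ... | false = sym (*-identityˡ B)

-- Weighted degrees and colour counts

weightedDegree : (G : Graph) → (Fin (nE G) → ℕ) → Fin (nV G) → ℕ
weightedDegree G w x = ∑[ e < nE G ] (if incident G x e then w e else 0)

vsum≡weightedDegree : ∀ G f x → vsum G f x ≡ weightedDegree G (label G f) x
vsum≡weightedDegree G f x = trans (cong List.sum (map-tabulate id h)) (sum-tabulate h)
  where
  h : Fin (nE G) → ℕ
  h e = if incident G x e then label G f e else 0

endpointsIn : (G : Graph) → (Fin (nV G) → Bool) → Fin (nE G) → ℕ
endpointsIn G side e = ∑[ x < nV G ] (if side x ∧ incident G x e then 1 else 0)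

∑-weightedDegree-side : ∀ G w (side : Fin (nV G) → Bool) → (∀ e → endpointsIn G side e ≡ 1) →
  ∑[ x < nV G ] (if side x then weightedDegree G w x else 0) ≡ ∑[ e < nE G ] w e
∑-weightedDegree-side G w side once = begin
  ∑[ x < nV G ] (if side x then weightedDegree G w x else 0)
    ≡⟨ sum-cong-≗ pushIf ⟩
  ∑[ x < nV G ] ∑[ e < nE G ] term x e
    ≡⟨ ∑-comm term ⟩
  ∑[ e < nE G ] ∑[ x < nV G ] term x e
    ≡⟨ sum-cong-≗ (λ e → trans (sum-cong-≗ (λ x → if-then-0≡* (side x ∧ incident G x e) (w e)))
                                (sym (*-distribʳ-sum (w e) (λ x → if side x ∧ incident G x e then 1 else 0)))) ⟩
  ∑[ e < nE G ] (endpointsIn G side e * w e)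
    ≡⟨ sum-cong-≗ (λ e → trans (cong (_* w e) (once e)) (*-identityˡ (w e))) ⟩
  ∑[ e < nE G ] w e ∎
  where
  open ≡-Reasoning
  term : Fin (nV G) → Fin (nE G) → ℕ
  term x e = if side x ∧ incident G x e then w e else 0
  pushIf : ∀ x → (if side x then weightedDegree G w x else 0) ≡ ∑[ e < nE G ] term x e
  pushIf x with side x
  ... | true  = refl
  ... | false = sym (sum-replicate-zero (nE G))

equitable-bichromatic⇒≡ : ∀ G w (side : Fin (nV G) → Bool) {A B} →
  (∀ e → endpointsIn G side e ≡ 1) → (∀ e → endpointsIn G (not ∘ side) e ≡ 1) →
  count side ≡ count (not ∘ side) → .{{_ : NonZero (count side)}} →
  (∀ x → weightedDegree G w x ≡ (if side x then A else B)) → A ≡ B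
equitable-bichromatic⇒≡ G w side {A} {B} crossed crossed′ equitable sums =
  *-cancelˡ-≡ A B (count side) (begin
    count side * A
      ≡⟨ ∑-sideConstant side A B ⟨
    ∑[ x < nV G ] (if side x then (if side x then A else B) else 0)
      ≡⟨ sum-cong-≗ (λ x → cong (if side x then_else 0) (sums x)) ⟨
    ∑[ x < nV G ] (if side x then weightedDegree G w x else 0)
      ≡⟨ ∑-weightedDegree-side G w side crossed ⟩
    ∑[ e < nE G ] w e
      ≡⟨ ∑-weightedDegree-side G w (not ∘ side) crossed′ ⟨
    ∑[ x < nV G ] (if not (side x) then weightedDegree G w x else 0)
      ≡⟨ sum-cong-≗ (λ x → cong (if not (side x) then_else 0) (sums x)) ⟩
    ∑[ x < nV G ] (if not (side x) then (if side x then A else B) else 0)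
      ≡⟨ ∑-otherSideConstant side A B ⟩
    count (not ∘ side) * B
      ≡⟨ cong (_* B) equitable ⟨
    count side * B ∎)
  where open ≡-Reasoning

unique⊆⇒length≤ : ∀ {xs ys : List ℕ} → Unique xs → xs ⊆ ys → length xs ≤ length ys
unique⊆⇒length≤ {[]}     _          _     = z≤n
unique⊆⇒length≤ {x ∷ xs} {ys} (x∉xs ∷ u) xs⊆ys =
  ≤-trans (s≤s (unique⊆⇒length≤ u xs⊆others)) (filter-notAll (λ y → ¬? (x ≟ y)) ys x∈ys)
  where
  x∈ys = Any.map (λ x≡y x≢y → x≢y x≡y) (xs⊆ys (here refl))
  xs⊆others : xs ⊆ filter (λ y → ¬? (x ≟ y)) ys
  xs⊆others z∈xs = ∈-filter⁺ (λ y → ¬? (x ≟ y)) (xs⊆ys (there z∈xs)) (All.lookup x∉xs z∈xs)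

colours : (G : Graph) → Labeling G → List ℕ
colours G f = deduplicate _≟_ (map (vsum G f) (allFin (nV G)))

vsum∈colours : ∀ G f v → vsum G f v ∈ colours G f
vsum∈colours G f v = ∈-deduplicate⁺ _≟_ (∈-map⁺ (vsum G f) (∈-allFin v))

distinct⇒3≤numColors : ∀ G f {u v w} →
  vsum G f u ≢ vsum G f v → vsum G f u ≢ vsum G f w → vsum G f v ≢ vsum G f w →
  3 ≤ numColors G f
distinct⇒3≤numColors G f {u} {v} {w} u≢v u≢w v≢w =
  unique⊆⇒length≤ ((u≢v All.∷ u≢w All.∷ All.[]) ∷ (v≢w All.∷ All.[]) ∷ All.[] ∷ [])
    λ { (here refl)               → vsum∈colours G f u
      ; (there (here refl))         → vsum∈colours G f v
      ; (there (there (here refl))) → vsum∈colours G f w }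

numColors≤ : ∀ G f {k} (g : Fin k → ℕ) → (∀ v → ∃[ c ] vsum G f v ≡ g c) → numColors G f ≤ k
numColors≤ G f g inImage =
  ≤-trans (unique⊆⇒length≤ (deduplicate-! _≟_ _) colours⊆image) (≤-reflexive (length-tabulate g))
  where
  colours⊆image : colours G f ⊆ tabulate g
  colours⊆image y∈ with v , _ , refl ← ∈-map⁻ (vsum G f) (∈-deduplicate⁻ _≟_ _ y∈)
                   with c , eq ← inImage v = subst (_∈ tabulate g) (sym eq) (∈-tabulate⁺ c)

adjacent⇒vsum≢ : ∀ G f {e u v} → IsLocalAntimagic G f → ends G e ≡ (u , v) → vsum G f u ≢ vsum G f v
adjacent⇒vsum≢ G f {e} (_ , proper) refl = proper e

triangle⇒3≤numColors : ∀ G f {e₁ e₂ e₃ u v w} → IsLocalAntimagic G f →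
  ends G e₁ ≡ (u , v) → ends G e₂ ≡ (u , w) → ends G e₃ ≡ (v , w) → 3 ≤ numColors G f
triangle⇒3≤numColors G f la uv uw vw =
  distinct⇒3≤numColors G f (adjacent⇒vsum≢ G f la uv) (adjacent⇒vsum≢ G f la uw) (adjacent⇒vsum≢ G f la vw)

twoColours⇒path₂ : ∀ G f {u v w} → numColors G f < 3 →
  vsum G f u ≢ vsum G f v → vsum G f v ≢ vsum G f w → vsum G f w ≡ vsum G f u
twoColours⇒path₂ G f {u} {v} {w} few u≢v v≢w with vsum G f w ≟ vsum G f u
... | yes w≡u = w≡u
... | no  w≢u = contradiction (distinct⇒3≤numColors G f u≢v (w≢u ∘ sym) v≢w) (<⇒≱ few)

χla≡3 : ∀ G → (∃[ f ] IsLocalAntimagic G f × numColors G f ≤ 3) →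
        (∀ f → IsLocalAntimagic G f → 3 ≤ numColors G f) → χla≡ G 3
χla≡3 G (f , la , few) lower = (f , la , ≤-antisym few (lower f la)) , lower

-- Disjoint copies

copy : Vec (Fin 12) 16 → Graph
copy φ = record
  { nV   = 12
  ; nE   = 20
  ; ends = λ b → lookup φ (proj₁ (lookup baseEnds b)) , lookup φ (proj₂ (lookup baseEnds b))
  }

inCopy : ∀ {n} → Fin n → Fin 12 × Fin 12 → Fin (n * 12) × Fin (n * 12)
inCopy i (x , y) = combine i x , combine i y

ends-combine : ∀ φ n (i : Fin n) (b : Fin 20) → ends (mergedCopies φ n) (combine i b) ≡ inCopy i (ends (copy φ) b)
ends-combine φ n i b = cong (λ (j , c) → inCopy j (ends (copy φ) c)) (remQuot-combine i b)

isEndOf : ∀ {V} → Fin V → Fin V × Fin V → Bool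
isEndOf x (p , q) = ⌊ p ≟ᶠ x ⌋ ∨ ⌊ q ≟ᶠ x ⌋

combine≟combine : ∀ {n} (i : Fin n) (x y : Fin 12) → ⌊ combine i x ≟ᶠ combine i y ⌋ ≡ ⌊ x ≟ᶠ y ⌋
combine≟combine i x y with combine i x ≟ᶠ combine i y | x ≟ᶠ y
... | yes _ | yes _    = refl
... | no  _ | no  _    = refl
... | yes p | no  x≢y  = contradiction (combine-injectiveʳ i x i y p) x≢y
... | no  p | yes refl = contradiction refl p

incident-combine : ∀ φ n (i : Fin n) x b →
  incident (mergedCopies φ n) (combine i x) (combine i b) ≡ incident (copy φ) x b
incident-combine φ n i x b =
  trans (cong (isEndOf (combine i x)) (ends-combine φ n i b))
        (cong₂ _∨_ (combine≟combine i _ x) (combine≟combine i _ x))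

incident-combine-other : ∀ φ n {i j : Fin n} x b → j ≢ i →
  incident (mergedCopies φ n) (combine i x) (combine j b) ≡ false
incident-combine-other φ n {i} {j} x b j≢i =
  trans (cong (isEndOf (combine i x)) (ends-combine φ n j b)) (cong₂ _∨_ (other _) (other _))
  where
  other : ∀ y → ⌊ combine j y ≟ᶠ combine i x ⌋ ≡ false
  other y with combine j y ≟ᶠ combine i x
  ... | yes p = contradiction (combine-injectiveˡ j y i x p) j≢i
  ... | no  _ = refl

weightedDegree-combine : ∀ φ n (w : Fin (n * 20) → ℕ) (i : Fin n) x →
  weightedDegree (mergedCopies φ n) w (combine i x) ≡ weightedDegree (copy φ) (w ∘ combine i) x
weightedDegree-combine φ n w i x = begin
  weightedDegree (mergedCopies φ n) w (combine i x)
    ≡⟨ ∑-combine n term ⟩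
  ∑[ j < n ] ∑[ b < 20 ] term (combine j b)
    ≡⟨ ∑-concentrated _ i (λ j j≢i → trans (sum-cong-≗ (λ b → cong (if_then w (combine j b) else 0)
                                                                  (incident-combine-other φ n x b j≢i)))
                                             (sum-replicate-zero 20)) ⟩
  ∑[ b < 20 ] term (combine i b)
    ≡⟨ sum-cong-≗ (λ b → cong (if_then w (combine i b) else 0) (incident-combine φ n i x b)) ⟩
  weightedDegree (copy φ) (w ∘ combine i) x ∎
  where
  open ≡-Reasoning
  term : Fin (n * 20) → ℕ
  term e = if incident (mergedCopies φ n) (combine i x) e then w e else 0

-- Affine forms and block labelings

-- (a , b , c) stands for a + b k + c r, where for copy i we take k = toℕ i and
-- r = toℕ (opposite i), so that n = 1 + k + r.  Labels and vertex sums of block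
-- labelings are such forms, and closed forms can be compared by evaluation.
Affine : Set
Affine = ℕ × ℕ × ℕ

⟦_⟧ : Affine → ℕ → ℕ → ℕ
⟦ a , b , c ⟧ k r = a + b * k + c * r

infixl 6 _⊕_
infixr 7 _⊛_

0ᴬ : Affine
0ᴬ = 0 , 0 , 0

_⊕_ : Affine → Affine → Affine
(a , b , c) ⊕ (a′ , b′ , c′) = a + a′ , b + b′ , c + c′

_⊛_ : ℕ → Affine → Affine
t ⊛ (a , b , c) = t * a , t * b , t * c

∑ᴬ : ∀ {N} → (Fin N → Affine) → Affine
∑ᴬ = Vector.foldr _⊕_ 0ᴬ

⟦⊕⟧ : ∀ F G k r → ⟦ F ⊕ G ⟧ k r ≡ ⟦ F ⟧ k r + ⟦ G ⟧ k r
⟦⊕⟧ (a , b , c) (a′ , b′ , c′) = lemma a b c a′ b′ c′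
  where
  lemma : ∀ a b c a′ b′ c′ k r →
          a + a′ + (b + b′) * k + (c + c′) * r ≡ a + b * k + c * r + (a′ + b′ * k + c′ * r)
  lemma = solve-∀

⟦⊛⟧ : ∀ t F k r → ⟦ t ⊛ F ⟧ k r ≡ t * ⟦ F ⟧ k r
⟦⊛⟧ t (a , b , c) = lemma t a b c
  where
  lemma : ∀ t a b c k r → t * a + t * b * k + t * c * r ≡ t * (a + b * k + c * r)
  lemma = solve-∀

⟦∑ᴬ⟧ : ∀ {N} (F : Fin N → Affine) k r → ⟦ ∑ᴬ F ⟧ k r ≡ ∑[ j < N ] ⟦ F j ⟧ k r
⟦∑ᴬ⟧ {zero}  F k r = refl
⟦∑ᴬ⟧ {suc N} F k r =
  trans (⟦⊕⟧ (F zero) (∑ᴬ (F ∘ suc)) k r) (cong (⟦ F zero ⟧ k r +_) (⟦∑ᴬ⟧ (F ∘ suc) k r))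

Dominates : Affine → Affine → Set
Dominates (a , b , c) (a′ , b′ , c′) = a < a′ × b ≤ b′ × c ≤ c′

dominates? : Decidable Dominates
dominates? (a , b , c) (a′ , b′ , c′) = a <? a′ ×-dec b ≤? b′ ×-dec c ≤? c′

Separated : Affine → Affine → Set
Separated F G = Dominates F G ⊎ Dominates G F

separated? : Decidable Separated
separated? F G = dominates? F G ⊎-dec dominates? G F

dominates⇒< : ∀ {F G} → Dominates F G → ∀ k r → ⟦ F ⟧ k r < ⟦ G ⟧ k r
dominates⇒< (a<a′ , b≤b′ , c≤c′) k r =
  +-mono-<-≤ (+-mono-<-≤ a<a′ (*-monoˡ-≤ k b≤b′)) (*-monoˡ-≤ r c≤c′)

separated⇒≢ : ∀ {F G} → Separated F G → ∀ k r → ⟦ F ⟧ k r ≢ ⟦ G ⟧ k r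
separated⇒≢ (inj₁ F≺G) k r = <⇒≢ (dominates⇒< F≺G k r)
separated⇒≢ (inj₂ G≺F) k r = ≢-sym (<⇒≢ (dominates⇒< G≺F k r))

balanced : ℕ × ℕ → Affine
balanced (C , A) = C , A , A

⟦balanced⟧ : ∀ l {k r m} → k + r ≡ m → ⟦ balanced l ⟧ k r ≡ proj₁ l + proj₂ l * m
⟦balanced⟧ (C , A) {k} {r} refl = lemma C A k r
  where
  lemma : ∀ C A k r → C + A * k + A * r ≡ C + A * (k + r)
  lemma = solve-∀

injective⇒surjective : ∀ {n} {f : Fin n → Fin n} → Injective _≡_ _≡_ f → Surjective _≡_ _≡_ f
injective⇒surjective {suc n} {f} f-injective y with any? (λ x → f x ≟ᶠ y)
... | yes (x , fx≡y) = x , λ { refl → fx≡y }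
... | no  ∄x         = contradiction (injective⇒≤ avoid-injective) 1+n≰n
  where
  y≢f : ∀ x → y ≢ f x
  y≢f x y≡fx = ∄x (x , sym y≡fx)
  avoid : Fin (suc n) → Fin n
  avoid x = punchOut (y≢f x)
  avoid-injective : Injective _≡_ _≡_ avoid
  avoid-injective {x} {x′} eq = f-injective (punchOut-injective (y≢f x) (y≢f x′) eq)

cast-injective : ∀ {m n} .(eq : m ≡ n) → Injective _≡_ _≡_ (cast eq)
cast-injective eq {x} {y} cx≡cy = toℕ-injective (begin
  toℕ x           ≡⟨ toℕ-cast eq x ⟨
  toℕ (cast eq x) ≡⟨ cong toℕ cx≡cy ⟩
  toℕ (cast eq y) ≡⟨ toℕ-cast eq y ⟩
  toℕ y           ∎)
  where open ≡-Reasoning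

remQuot-injective : ∀ {m} n → Injective _≡_ _≡_ (remQuot {m} n)
remQuot-injective {m} n {x} {y} eq = begin
  x                                 ≡⟨ combine-remQuot {m} n x ⟨
  uncurry combine (remQuot {m} n x) ≡⟨ cong (uncurry combine) eq ⟩
  uncurry combine (remQuot {m} n y) ≡⟨ combine-remQuot {m} n y ⟩
  y                                 ∎
  where open ≡-Reasoning

suc-toℕ+toℕ-opposite : ∀ {n} (i : Fin n) → suc (toℕ i + toℕ (opposite i)) ≡ n
suc-toℕ+toℕ-opposite {suc n} i =
  cong suc (trans (cong (toℕ i +_) (opposite-prop i)) (m+[n∸m]≡n (toℕ≤pred[n] i)))

-- Base edge b takes its labels from half proj₂ (slot b) of block proj₁ (slot b); a block
-- is split into its lower and upper half, or, if it alternates, into its even and odd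
-- positions.  Within that half, copy i takes position i if b is ascending, else n - 1 - i.
record BlockScheme : Set where
  field
    slot      : Fin 20 → Fin 10 × Fin 2
    alternate : Fin 10 → Bool
    ascending : Fin 20 → Bool

module BlockLabeling (S : BlockScheme) where
  open BlockScheme S

  module _ {n : ℕ} where
    inBlock : Bool → Fin 2 → Fin n → Fin (2 * n)
    inBlock false o j = combine o j
    inBlock true  o j = cast (*-comm n 2) (combine j o)

    inBlock-injective : ∀ c {o o′ j j′} → inBlock c o j ≡ inBlock c o′ j′ → o ≡ o′ × j ≡ j′
    inBlock-injective false eq = combine-injective _ _ _ _ eq
    inBlock-injective true  eq = swap (combine-injective _ _ _ _ (cast-injective (*-comm n 2) eq))

    orient : Bool → Fin n → Fin n
    orient true  i = i
    orient false i = opposite i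

    orient-injective : ∀ c → Injective _≡_ _≡_ (orient c)
    orient-injective true  eq = eq
    orient-injective false {i} {i′} eq = begin
      i                       ≡⟨ opposite-involutive i ⟨
      opposite (opposite i)   ≡⟨ cong opposite eq ⟩
      opposite (opposite i′)  ≡⟨ opposite-involutive i′ ⟩
      i′                      ∎
      where open ≡-Reasoning

    blocks : 10 * (2 * n) ≡ n * 20
    blocks = trans (sym (*-assoc 10 2 n)) (*-comm 20 n)

    place : Fin 10 × Fin 2 → Fin n → Fin (n * 20)
    place (q , o) j = cast blocks (combine q (inBlock (alternate q) o j))

    place-injective : ∀ {s s′ j j′} → place s j ≡ place s′ j′ → s ≡ s′ × j ≡ j′
    place-injective {q , o} {q′ , o′} {j} {j′} eq = same-block (combine-injectiveˡ q _ q′ _ combine≡) combine≡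
      where
      combine≡ = cast-injective blocks eq
      same-block : q ≡ q′ → combine q (inBlock (alternate q) o j) ≡ combine q′ (inBlock (alternate q′) o′ j′) →
                   (q , o) ≡ (q′ , o′) × j ≡ j′
      same-block refl c≡ with o≡o′ , j≡j′ ← inBlock-injective (alternate q) (combine-injectiveʳ q _ q _ c≡) =
        cong (q ,_) o≡o′ , j≡j′

    labelAt : Fin n → Fin 20 → Fin (n * 20)
    labelAt i b = place (slot b) (orient (ascending b) i)

  labeling : ∀ n → Fin (n * 20) → Fin (n * 20)
  labeling n e = uncurry labelAt (remQuot {n} 20 e)

  labeling-bijective : Injective _≡_ _≡_ slot → ∀ n → Bijective _≡_ _≡_ (labeling n)
  labeling-bijective slot-injective n = injective , injective⇒surjective injective
    where
    labelAt-injective : ∀ {i i′ : Fin n} {b b′} → labelAt i b ≡ labelAt i′ b′ → (i , b) ≡ (i′ , b′)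
    labelAt-injective {i} {i′} {b} {b′} eq = same-edge (slot-injective (proj₁ placed)) (proj₂ placed)
      where
      placed = place-injective {n} {slot b} {slot b′} eq
      same-edge : b ≡ b′ → orient (ascending b) i ≡ orient (ascending b′) i′ → (i , b) ≡ (i′ , b′)
      same-edge refl o≡ = cong (_, b) (orient-injective (ascending b) o≡)
    injective : Injective _≡_ _≡_ (labeling n)
    injective eq = remQuot-injective {n} 20 (labelAt-injective eq)

  n̂ : Affine
  n̂ = 1 , 1 , 1

  ĉ : ℕ → Affine
  ĉ a = a , 0 , 0

  orientForm : Bool → Affine
  orientForm true  = 0 , 1 , 0
  orientForm false = 0 , 0 , 1

  inBlockForm : Bool → ℕ → Affine → Affine
  inBlockForm false o J = o ⊛ n̂ ⊕ J
  inBlockForm true  o J = 2 ⊛ J ⊕ ĉ o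

  labelForm : Fin 20 → Affine
  labelForm b = ĉ 1 ⊕ (2 * toℕ q) ⊛ n̂ ⊕ inBlockForm (alternate q) (toℕ o) (orientForm (ascending b))
    where
    q = proj₁ (slot b)
    o = proj₂ (slot b)

  module _ {n : ℕ} (i : Fin n) where
    private
      k = toℕ i
      r = toℕ (opposite i)

    ⟦n̂⟧ : ⟦ n̂ ⟧ k r ≡ n
    ⟦n̂⟧ = trans (lemma k r) (suc-toℕ+toℕ-opposite i)
      where
      lemma : ∀ k r → 1 + 1 * k + 1 * r ≡ suc (k + r)
      lemma = solve-∀

    ⟦ĉ⟧ : ∀ a → ⟦ ĉ a ⟧ k r ≡ a
    ⟦ĉ⟧ a = trans (+-identityʳ (a + 0)) (+-identityʳ a)

    toℕ-orient : ∀ c → toℕ (orient c i) ≡ ⟦ orientForm c ⟧ k r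
    toℕ-orient true  = lemma k r
      where
      lemma : ∀ k r → k ≡ 0 + 1 * k + 0 * r
      lemma = solve-∀
    toℕ-orient false = lemma k r
      where
      lemma : ∀ k r → r ≡ 0 + 0 * k + 1 * r
      lemma = solve-∀

    toℕ-inBlock : ∀ c o {j : Fin n} J → toℕ j ≡ ⟦ J ⟧ k r → toℕ (inBlock c o j) ≡ ⟦ inBlockForm c (toℕ o) J ⟧ k r
    toℕ-inBlock false o {j} J toℕj≡ = begin
      toℕ (combine o j)              ≡⟨ toℕ-combine o j ⟩
      n * toℕ o + toℕ j              ≡⟨ cong₂ _+_ (*-comm n (toℕ o)) toℕj≡ ⟩
      toℕ o * n + ⟦ J ⟧ k r          ≡⟨ cong (λ n → toℕ o * n + ⟦ J ⟧ k r) ⟦n̂⟧ ⟨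
      toℕ o * ⟦ n̂ ⟧ k r + ⟦ J ⟧ k r  ≡⟨ cong (_+ ⟦ J ⟧ k r) (⟦⊛⟧ (toℕ o) n̂ k r) ⟨
      ⟦ toℕ o ⊛ n̂ ⟧ k r + ⟦ J ⟧ k r  ≡⟨ ⟦⊕⟧ (toℕ o ⊛ n̂) J k r ⟨
      ⟦ toℕ o ⊛ n̂ ⊕ J ⟧ k r          ∎
      where open ≡-Reasoning
    toℕ-inBlock true o {j} J toℕj≡ = begin
      toℕ (cast (*-comm n 2) (combine j o)) ≡⟨ toℕ-cast (*-comm n 2) (combine j o) ⟩
      toℕ (combine j o)                     ≡⟨ toℕ-combine j o ⟩
      2 * toℕ j + toℕ o                     ≡⟨ cong₂ _+_ (cong (2 *_) (sym toℕj≡)) (⟦ĉ⟧ (toℕ o)) ⟨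
      2 * ⟦ J ⟧ k r + ⟦ ĉ (toℕ o) ⟧ k r     ≡⟨ cong (_+ ⟦ ĉ (toℕ o) ⟧ k r) (⟦⊛⟧ 2 J k r) ⟨
      ⟦ 2 ⊛ J ⟧ k r + ⟦ ĉ (toℕ o) ⟧ k r     ≡⟨ ⟦⊕⟧ (2 ⊛ J) (ĉ (toℕ o)) k r ⟨
      ⟦ 2 ⊛ J ⊕ ĉ (toℕ o) ⟧ k r             ∎
      where open ≡-Reasoning

    toℕ-labelAt : ∀ b → suc (toℕ (labelAt i b)) ≡ ⟦ labelForm b ⟧ k r
    toℕ-labelAt b = begin
      suc (toℕ (cast (blocks {n}) (combine q x)))        ≡⟨ cong suc (toℕ-cast (blocks {n}) (combine q x)) ⟩
      suc (toℕ (combine q x))                           ≡⟨ cong suc (toℕ-combine q x) ⟩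
      1 + 2 * n * toℕ q + toℕ x                         ≡⟨ cong₂ (λ m y → 1 + m + y) (*-comm (2 * n) (toℕ q)) toℕx≡ ⟩
      1 + toℕ q * (2 * n) + ⟦ X ⟧ k r                   ≡⟨ cong (λ m → 1 + m + ⟦ X ⟧ k r) (*-assoc (toℕ q) 2 n) ⟨
      1 + toℕ q * 2 * n + ⟦ X ⟧ k r                     ≡⟨ cong (λ m → 1 + m * n + ⟦ X ⟧ k r) (*-comm (toℕ q) 2) ⟩
      1 + 2 * toℕ q * n + ⟦ X ⟧ k r                     ≡⟨ cong (λ n → 1 + 2 * toℕ q * n + ⟦ X ⟧ k r) ⟦n̂⟧ ⟨
      1 + 2 * toℕ q * ⟦ n̂ ⟧ k r + ⟦ X ⟧ k r             ≡⟨ cong₂ (λ a m → a + m + ⟦ X ⟧ k r) (⟦ĉ⟧ 1) (⟦⊛⟧ (2 * toℕ q) n̂ k r) ⟨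
      ⟦ ĉ 1 ⟧ k r + ⟦ (2 * toℕ q) ⊛ n̂ ⟧ k r + ⟦ X ⟧ k r ≡⟨ cong (_+ ⟦ X ⟧ k r) (⟦⊕⟧ (ĉ 1) ((2 * toℕ q) ⊛ n̂) k r) ⟨
      ⟦ ĉ 1 ⊕ (2 * toℕ q) ⊛ n̂ ⟧ k r + ⟦ X ⟧ k r         ≡⟨ ⟦⊕⟧ (ĉ 1 ⊕ (2 * toℕ q) ⊛ n̂) X k r ⟨
      ⟦ labelForm b ⟧ k r                               ∎
      where
      open ≡-Reasoning
      q = proj₁ (slot b)
      o = proj₂ (slot b)
      x = inBlock (alternate q) o (orient (ascending b) i)
      X = inBlockForm (alternate q) (toℕ o) (orientForm (ascending b))
      toℕx≡ : toℕ x ≡ ⟦ X ⟧ k r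
      toℕx≡ = toℕ-inBlock (alternate q) o (orientForm (ascending b)) (toℕ-orient (ascending b))

  vertexForm : Vec (Fin 12) 16 → Fin 12 → Affine
  vertexForm φ x = ∑ᴬ (λ b → if incident (copy φ) x b then labelForm b else 0ᴬ)

  vsum≡⟦vertexForm⟧ : ∀ φ {n} (i : Fin n) x →
    vsum (mergedCopies φ n) (labeling n) (combine i x) ≡ ⟦ vertexForm φ x ⟧ (toℕ i) (toℕ (opposite i))
  vsum≡⟦vertexForm⟧ φ {n} i x = begin
    vsum (mergedCopies φ n) (labeling n) (combine i x)
      ≡⟨ vsum≡weightedDegree (mergedCopies φ n) (labeling n) (combine i x) ⟩
    weightedDegree (mergedCopies φ n) (label (mergedCopies φ n) (labeling n)) (combine i x)
      ≡⟨ weightedDegree-combine φ n (label (mergedCopies φ n) (labeling n)) i x ⟩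
    ∑[ b < 20 ] (if incident (copy φ) x b then suc (toℕ (labeling n (combine i b))) else 0)
      ≡⟨ sum-cong-≗ (λ b → termwise (incident (copy φ) x b) b) ⟩
    ∑[ b < 20 ] ⟦ if incident (copy φ) x b then labelForm b else 0ᴬ ⟧ k r
      ≡⟨ ⟦∑ᴬ⟧ (λ b → if incident (copy φ) x b then labelForm b else 0ᴬ) k r ⟨
    ⟦ vertexForm φ x ⟧ k r ∎
    where
    open ≡-Reasoning
    k = toℕ i
    r = toℕ (opposite i)
    termwise : ∀ c b → (if c then suc (toℕ (labeling n (combine i b))) else 0) ≡ ⟦ if c then labelForm b else 0ᴬ ⟧ k r
    termwise false b = refl
    termwise true  b = trans (cong (λ (j , c) → suc (toℕ (labelAt j c))) (remQuot-combine i b)) (toℕ-labelAt i b)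

  module _ (φ : Vec (Fin 12) 16) (slot-injective : Injective _≡_ _≡_ slot)
           (separated : ∀ b → Separated (vertexForm φ (proj₁ (ends (copy φ) b))) (vertexForm φ (proj₂ (ends (copy φ) b))))
           (lines : Fin 3 → ℕ × ℕ) (balanced-forms : ∀ x → ∃[ c ] vertexForm φ x ≡ balanced (lines c))
           where

    labeling-localAntimagic : ∀ n → IsLocalAntimagic (mergedCopies φ n) (labeling n)
    labeling-localAntimagic n = labeling-bijective slot-injective n , proper
      where
      proper : ∀ e → vsum (mergedCopies φ n) (labeling n) (proj₁ (ends (mergedCopies φ n) e)) ≡
                     vsum (mergedCopies φ n) (labeling n) (proj₂ (ends (mergedCopies φ n) e)) → ⊥
      proper e sums≡ = separated⇒≢ (separated b) (toℕ i) (toℕ (opposite i))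
        (trans (sym (vsum≡⟦vertexForm⟧ φ i (proj₁ (ends (copy φ) b))))
               (trans sums≡ (vsum≡⟦vertexForm⟧ φ i (proj₂ (ends (copy φ) b)))))
        where
        i = proj₁ (remQuot {n} 20 e)
        b = proj₂ (remQuot {n} 20 e)

    labeling-numColors≤3 : ∀ m → numColors (mergedCopies φ (suc m)) (labeling (suc m)) ≤ 3
    labeling-numColors≤3 m = numColors≤ G (labeling (suc m)) value onLine
      where
      G = mergedCopies φ (suc m)
      value : Fin 3 → ℕ
      value c = proj₁ (lines c) + proj₂ (lines c) * m
      OnLine : Fin (suc m * 12) → Set
      OnLine v = ∃[ c ] vsum G (labeling (suc m)) v ≡ value c
      onLine-combine : ∀ i x → OnLine (combine i x)
      onLine-combine i x = c , (begin
          vsum G (labeling (suc m)) (combine i x)            ≡⟨ vsum≡⟦vertexForm⟧ φ i x ⟩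
          ⟦ vertexForm φ x ⟧ (toℕ i) (toℕ (opposite i))      ≡⟨ cong (λ F → ⟦ F ⟧ (toℕ i) (toℕ (opposite i))) form≡ ⟩
          ⟦ balanced (lines c) ⟧ (toℕ i) (toℕ (opposite i))  ≡⟨ ⟦balanced⟧ (lines c) (suc-injective (suc-toℕ+toℕ-opposite i)) ⟩
          value c                                            ∎)
        where
        open ≡-Reasoning
        c = proj₁ (balanced-forms x)
        form≡ = proj₂ (balanced-forms x)
      onLine : ∀ v → OnLine v
      onLine v = subst OnLine (combine-remQuot {suc m} 12 v)
                       (onLine-combine (proj₁ (remQuot {suc m} 12 v)) (proj₂ (remQuot {suc m} 12 v)))

  slot-injective? : Dec (Injective _≡_ _≡_ slot)
  slot-injective? = map′ (λ inj {b} {b′} → inj b b′) (λ inj b b′ → inj)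
    (all? λ b → all? λ b′ → ≡-dec _≟ᶠ_ _≟ᶠ_ (slot b) (slot b′) →-dec b ≟ᶠ b′)

  edges-separated? : ∀ φ → Dec (∀ b → Separated (vertexForm φ (proj₁ (ends (copy φ) b))) (vertexForm φ (proj₂ (ends (copy φ) b))))
  edges-separated? φ = all? λ b → separated? _ _

  forms-balanced? : ∀ φ (lines : Fin 3 → ℕ × ℕ) → Dec (∀ x → ∃[ c ] vertexForm φ x ≡ balanced (lines c))
  forms-balanced? φ lines = all? λ x → any? λ c → ≡-dec _≟_ (≡-dec _≟_ _≟_) (vertexForm φ x) (balanced (lines c))

  upperBound : ∀ φ (lines : Fin 3 → ℕ × ℕ) →
    {True slot-injective?} → {True (edges-separated? φ)} → {True (forms-balanced? φ lines)} →
    ∀ m → ∃[ f ] IsLocalAntimagic (mergedCopies φ (suc m)) f × numColors (mergedCopies φ (suc m)) f ≤ 3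
  upperBound φ lines {injective} {separated} {balanced-forms} m =
    labeling (suc m) , labeling-localAntimagic φ inj sep lines bal (suc m) , labeling-numColors≤3 φ inj sep lines bal m
    where
    inj = toWitness injective
    sep = toWitness separated
    bal = toWitness balanced-forms

-- The graphs H₁, H₂, H₃

blockScheme : Vec (Fin 20) 20 → Vec Bool 10 → Vec Bool 20 → BlockScheme
blockScheme slots alternates ascendings = record
  { slot      = λ b → remQuot 2 (lookup slots b)
  ; alternate = lookup alternates
  ; ascending = lookup ascendings
  }

scheme₁ : BlockScheme
scheme₁ = blockScheme
  (# 7 ∷ # 13 ∷ # 8 ∷ # 5 ∷ # 18 ∷ # 1 ∷ # 10 ∷ # 2 ∷ # 0 ∷ # 11 ∷
   # 3 ∷ # 19 ∷ # 4 ∷ # 6 ∷ # 12 ∷ # 9 ∷ # 16 ∷ # 14 ∷ # 17 ∷ # 15 ∷ [])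
  (true ∷ true ∷ false ∷ true ∷ true ∷ false ∷ false ∷ false ∷ false ∷ false ∷ [])
  (true ∷ false ∷ true ∷ false ∷ true ∷ false ∷ true ∷ false ∷ true ∷ false ∷
   true ∷ false ∷ true ∷ false ∷ true ∷ false ∷ false ∷ false ∷ true ∷ true ∷ [])

lines₁ : Fin 3 → ℕ × ℕ
lines₁ = lookup ((30 , 29) ∷ (36 , 34) ∷ (39 , 37) ∷ [])

scheme₂ : BlockScheme
scheme₂ = blockScheme
  (# 6 ∷ # 15 ∷ # 18 ∷ # 8 ∷ # 5 ∷ # 17 ∷ # 12 ∷ # 11 ∷ # 10 ∷ # 14 ∷
   # 19 ∷ # 4 ∷ # 9 ∷ # 16 ∷ # 13 ∷ # 7 ∷ # 2 ∷ # 0 ∷ # 1 ∷ # 3 ∷ [])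
  (false ∷ false ∷ false ∷ false ∷ false ∷ false ∷ true ∷ true ∷ true ∷ true ∷ [])
  (true ∷ false ∷ true ∷ false ∷ true ∷ false ∷ true ∷ false ∷ true ∷ false ∷
   true ∷ false ∷ true ∷ false ∷ true ∷ false ∷ true ∷ false ∷ true ∷ false ∷ [])

lines₂ : Fin 3 → ℕ × ℕ
lines₂ = lookup ((26 , 24) ∷ (29 , 28) ∷ (50 , 48) ∷ [])

scheme₃ : BlockScheme
scheme₃ = blockScheme
  (# 7 ∷ # 0 ∷ # 9 ∷ # 16 ∷ # 6 ∷ # 13 ∷ # 18 ∷ # 10 ∷ # 2 ∷ # 12 ∷
   # 15 ∷ # 3 ∷ # 11 ∷ # 1 ∷ # 4 ∷ # 17 ∷ # 19 ∷ # 8 ∷ # 14 ∷ # 5 ∷ [])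
  (false ∷ true ∷ false ∷ true ∷ false ∷ true ∷ false ∷ false ∷ true ∷ false ∷ [])
  (true ∷ false ∷ true ∷ false ∷ true ∷ false ∷ true ∷ false ∷ true ∷ false ∷
   true ∷ false ∷ true ∷ false ∷ true ∷ false ∷ false ∷ true ∷ false ∷ true ∷ [])

lines₃ : Fin 3 → ℕ × ℕ
lines₃ = lookup ((29 , 27) ∷ (36 , 35) ∷ (40 , 38) ∷ [])

upper₁ : ∀ m → ∃[ f ] IsLocalAntimagic (H₁ (suc m)) f × numColors (H₁ (suc m)) f ≤ 3
upper₁ = BlockLabeling.upperBound scheme₁ merge₁ lines₁

upper₂ : ∀ m → ∃[ f ] IsLocalAntimagic (H₂ (suc m)) f × numColors (H₂ (suc m)) f ≤ 3
upper₂ = BlockLabeling.upperBound scheme₂ merge₂ lines₂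

upper₃ : ∀ m → ∃[ f ] IsLocalAntimagic (H₃ (suc m)) f × numColors (H₃ (suc m)) f ≤ 3
upper₃ = BlockLabeling.upperBound scheme₃ merge₃ lines₃

-- The triangle u₈ u₁ v₈ of the first copy (v₇ is merged into u₁).
lower₂ : ∀ m f → IsLocalAntimagic (H₂ (suc m)) f → 3 ≤ numColors (H₂ (suc m)) f
lower₂ m f la =
  triangle⇒3≤numColors (H₂ (suc m)) f {edge (# 7)} {edge (# 19)} {edge (# 14)} la
    (ends-combine merge₂ (suc m) zero (# 7)) (ends-combine merge₂ (suc m) zero (# 19))
    (ends-combine merge₂ (suc m) zero (# 14))
  where
  edge : Fin 20 → Fin (suc m * 20)
  edge = combine {suc m} zero

-- The triangle u₁ u₂ v₂ of the first copy (v₁ is merged into u₁).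
lower₃ : ∀ m f → IsLocalAntimagic (H₃ (suc m)) f → 3 ≤ numColors (H₃ (suc m)) f
lower₃ m f la =
  triangle⇒3≤numColors (H₃ (suc m)) f {edge (# 0)} {edge (# 8)} {edge (# 16)} la
    (ends-combine merge₃ (suc m) zero (# 0)) (ends-combine merge₃ (suc m) zero (# 8))
    (ends-combine merge₃ (suc m) zero (# 16))
  where
  edge : Fin 20 → Fin (suc m * 20)
  edge = combine {suc m} zero

-- The class {u₁, u₃, v₂, v₄, v₆, v₈} of the bipartition of a copy of H₁.
side₁ : Fin 12 → Bool
side₁ = lookup (true ∷ false ∷ true ∷ false ∷ false ∷ false ∷ false ∷ true ∷ false ∷ true ∷ true ∷ true ∷ [])

-- Every vertex is reached from 0F = u₁ or 1F = u₂ by a path of length two.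
copy₁-twoSums : (s : Fin 12 → ℕ) →
  (∀ b → s (proj₁ (ends (copy merge₁) b)) ≢ s (proj₂ (ends (copy merge₁) b))) →
  (∀ {x y z} → s x ≢ s y → s y ≢ s z → s z ≡ s x) →
  ∀ x → s x ≡ (if side₁ x then s 0F else s 1F)
copy₁-twoSums s adj path₂ 0F             = refl
copy₁-twoSums s adj path₂ 1F             = refl
copy₁-twoSums s adj path₂ 2F             = path₂ (adj (# 0)) (adj (# 1))
copy₁-twoSums s adj path₂ 3F             = path₂ (adj (# 1)) (adj (# 2))
copy₁-twoSums s adj path₂ 4F             = path₂ (adj (# 1)) (≢-sym (adj (# 5)))
copy₁-twoSums s adj path₂ 5F             = path₂ (adj (# 1)) (adj (# 6))
copy₁-twoSums s adj path₂ 6F             = path₂ (adj (# 16)) (≢-sym (adj (# 8)))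
copy₁-twoSums s adj path₂ 7F             = path₂ (adj (# 0)) (adj (# 16))
copy₁-twoSums s adj path₂ 8F             = path₂ (adj (# 16)) (adj (# 9))
copy₁-twoSums s adj path₂ 9F             = path₂ (≢-sym (adj (# 3))) (adj (# 17))
copy₁-twoSums s adj path₂ (suc 9F)       = path₂ (adj (# 4)) (adj (# 18))
copy₁-twoSums s adj path₂ (suc (suc 9F)) = path₂ (≢-sym (adj (# 7))) (adj (# 19))

lower₁ : ∀ m f → IsLocalAntimagic (H₁ (suc m)) f → 3 ≤ numColors (H₁ (suc m)) f
lower₁ m f la = ≮⇒≥ twoColours-absurd
  where
  G = H₁ (suc m)
  s : Fin 12 → ℕ
  s x = vsum G f (combine {suc m} zero x)
  w : Fin 20 → ℕ
  w b = label G f (combine {suc m} zero b)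
  s≡weightedDegree : ∀ x → s x ≡ weightedDegree (copy merge₁) w x
  s≡weightedDegree x = trans (vsum≡weightedDegree G f (combine {suc m} zero x))
                             (weightedDegree-combine merge₁ (suc m) (label G f) zero x)
  adj : ∀ b → s (proj₁ (ends (copy merge₁) b)) ≢ s (proj₂ (ends (copy merge₁) b))
  adj b = adjacent⇒vsum≢ G f {combine {suc m} zero b} la (ends-combine merge₁ (suc m) zero b)
  twoColours-absurd : numColors G f < 3 → ⊥
  twoColours-absurd few = adj 0F (equitable-bichromatic⇒≡ (copy merge₁) w side₁
    (toWitness {a? = all? λ b → endpointsIn (copy merge₁) side₁ b ≟ 1} _)
    (toWitness {a? = all? λ b → endpointsIn (copy merge₁) (not ∘ side₁) b ≟ 1} _)
    refl
    (λ x → trans (sym (s≡weightedDegree x)) (copy₁-twoSums s adj (λ {x} {y} {z} → path₂ {x} {y} {z}) x)))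
    where
    path₂ : ∀ {x y z} → s x ≢ s y → s y ≢ s z → s z ≡ s x
    path₂ {x} {y} {z} = twoColours⇒path₂ G f {combine {suc m} zero x} {combine {suc m} zero y} {combine {suc m} zero z} few

theorem3p5 : ∀ (n : ℕ) → 1 ≤ n →
    χla≡ (H₁ n) 3 × χla≡ (H₂ n) 3 × χla≡ (H₃ n) 3
theorem3p5 zero    ()
theorem3p5 (suc m) _ =
  χla≡3 (H₁ (suc m)) (upper₁ m) (lower₁ m) ,
  χla≡3 (H₂ (suc m)) (upper₂ m) (lower₂ m) ,
  χla≡3 (H₃ (suc m)) (upper₃ m) (lower₃ m)
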